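{- Let $L$ be a finite algebra in $\mathcal V_2$ such that $\mathbf 1$ is join irreducible in $L$. Let $a,b_1,b_2\in L$ be such that $b_1\vee b_2\ll a$ and $b_1\wedge b_2\wedge(\mathbf 1-(\mathbf 1-a))=\mathbf 0$. Then there exist an extension $L'$ of $L$ in $\mathcal V_2$ and elements $a_1,a_2\in L'$ such that $a-a_2=a_1\ge b_1$, $a-a_1=a_2\ge b_2$, and $a_1\wedge a_2=b_1\wedge b_2$. If $a\ne\mathbf 0$, one can require $a_1,a_2$ both non-zero.
   Context: A co-Heyting algebra is a bounded distributive lattice $(L,\mathbf{0},\mathbf{1},\vee,\wedge)$ with a binary operation $-$ such that $a-b$ is the least $c\in L$ with $a\le b\vee c$; extensions are in the language $\{\mathbf 0,\mathbf 1,\vee,\wedge,-\}$. For $a,b$ write $b\ll a$ iff $a-b=a$ and $b\le a$. An element $a$ is join irreducible if it is not the join of any finite subset not containing $a$. $\mathcal V_2$ is the variety of co-Heyting algebras satisfying $(\mathbf 1-x)\wedge(\mathbf 1-(\mathbf 1-x))=\mathbf 0$. -}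

module Defs where

open import Data.Nat using (ℕ)
open import Data.Fin using (Fin)
open import Data.List using (List; foldr)
open import Data.List.Membership.Propositional using (_∈_)
open import Data.Product using (Σ; ∃; _×_)
open import Relation.Nullary using (¬_)
open import Relation.Binary.PropositionalEquality using (_≡_; _≢_)
open import Function.Definitions using (Injective)

record CoHeyting : Set₁ where
  field
    Carrier : Set
    𝟎 𝟏     : Carrier
    _∨_ _∧_ _-_ : Carrier → Carrier → Carrier
  infixr 6 _∨_
  infixr 7 _∧_
  infixl 8 _-_
  field
    ∨-assoc : ∀ x y z → (x ∨ y) ∨ z ≡ x ∨ (y ∨ z)
    ∧-assoc : ∀ x y z → (x ∧ y) ∧ z ≡ x ∧ (y ∧ z)
    ∨-comm  : ∀ x y → x ∨ y ≡ y ∨ x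
    ∧-comm  : ∀ x y → x ∧ y ≡ y ∧ x
    ∨-absorbs-∧ : ∀ x y → x ∨ (x ∧ y) ≡ x
    ∧-absorbs-∨ : ∀ x y → x ∧ (x ∨ y) ≡ x
    ∧-distribˡ-∨ : ∀ x y z → x ∧ (y ∨ z) ≡ (x ∧ y) ∨ (x ∧ z)
    ∨-identityʳ : ∀ x → x ∨ 𝟎 ≡ x
    ∧-identityʳ : ∀ x → x ∧ 𝟏 ≡ x

  _≤_ : Carrier → Carrier → Set
  x ≤ y = x ∨ y ≡ y

  field
    −-covers : ∀ a b → a ≤ (b ∨ (a - b))
    −-least  : ∀ a b c → a ≤ (b ∨ c) → (a - b) ≤ c

  _≪_ : Carrier → Carrier → Set
  b ≪ a = (a - b ≡ a) × (b ≤ a)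

  ⋁ : List Carrier → Carrier
  ⋁ = foldr _∨_ 𝟎

  JoinIrreducible : Carrier → Set
  JoinIrreducible a = ∀ (xs : List Carrier) → ¬ (a ∈ xs) → ⋁ xs ≢ a

InV₂ : CoHeyting → Set
InV₂ L = ∀ x → (𝟏 - x) ∧ (𝟏 - (𝟏 - x)) ≡ 𝟎
  where open CoHeyting L

Finite : CoHeyting → Set
Finite L = Σ ℕ λ n → Σ (Fin n → Carrier) λ f → ∀ x → ∃ λ i → f i ≡ x
  where open CoHeyting L

record IsHom (L L' : CoHeyting) (h : CoHeyting.Carrier L → CoHeyting.Carrier L') : Set where
  private
    module A = CoHeyting L
    module B = CoHeyting L'
  field
    pres-𝟎 : h A.𝟎 ≡ B.𝟎
    pres-𝟏 : h A.𝟏 ≡ B.𝟏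
    pres-∨ : ∀ x y → h (x A.∨ y) ≡ h x B.∨ h y
    pres-∧ : ∀ x y → h (x A.∧ y) ≡ h x B.∧ h y
    pres-− : ∀ x y → h (x A.- y) ≡ h x B.- h y

-- L' is an extension of L: L embeds into L' (injective homomorphism)
record Embedding (L L' : CoHeyting) : Set where
  field
    map    : CoHeyting.Carrier L → CoHeyting.Carrier L'
    isHom  : IsHom L L' map
    inj    : Injective _≡_ _≡_ map

-- With c = b₁ ∧ b₂, the extension L′ consists of compatible quadruples (r, y₁, y₂, z) taken from
-- the quotient ↑a, the intervals [b₂, a] and [b₁, a] and the ideal ↓c, into which L maps by
-- x ↦ (x ∨ a, (x ∧ a) ∨ b₂, (x ∧ a) ∨ b₁, x ∧ c). The element a splits as a₁ = (a, a, b₁, c) and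
-- a₂ = (a, b₂, a, c): both agree with a on ↑a and ↓c, but they sit at opposite ends of the two middle
-- intervals, so a₁ ∧ a₂ is the image of c, and a - (b₁ ∨ b₂) = a makes each of them the difference of
-- a and the other. V₂ is inherited from L coordinatewise; for the last coordinate this needs c ≤ ∼a,
-- which is the hypothesis c ∧ ∼∼a = 𝟎.
module Submission where

open import Defs
open import Data.Product using (Σ; _×_; _,_)
open import Relation.Binary.PropositionalEquality
  using (_≡_; _≢_; refl; sym; trans; cong; cong₂; subst; module ≡-Reasoning)
open import Axiom.UniquenessOfIdentityProofs.WithK using (uip)

module CoHeytingProperties (L : CoHeyting) where
  open CoHeyting L hiding (_≤_)

  infix 4 _≤_
  _≤_ : Carrier → Carrier → Set
  _≤_ = CoHeyting._≤_ L

  infix 9 ∼_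
  ∼_ : Carrier → Carrier
  ∼ x = 𝟏 - x

  infixr 2 _⟨≤⟩_
  _⟨≤⟩_ : ∀ {x y z} → x ≤ y → y ≤ z → x ≤ z
  _⟨≤⟩_ {x} {y} {z} x≤y y≤z = begin
    x ∨ z       ≡⟨ cong (x ∨_) (sym y≤z) ⟩
    x ∨ (y ∨ z) ≡⟨ sym (∨-assoc x y z) ⟩
    (x ∨ y) ∨ z ≡⟨ cong (_∨ z) x≤y ⟩
    y ∨ z       ≡⟨ y≤z ⟩
    z           ∎
    where open ≡-Reasoning

  ∨-idem : ∀ x → x ∨ x ≡ x
  ∨-idem x = trans (cong (x ∨_) (sym (∧-absorbs-∨ x x))) (∨-absorbs-∧ x (x ∨ x))

  ∧-idem : ∀ x → x ∧ x ≡ x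
  ∧-idem x = trans (cong (x ∧_) (sym (∨-absorbs-∧ x x))) (∧-absorbs-∨ x (x ∧ x))

  ≤-refl : ∀ {x} → x ≤ x
  ≤-refl {x} = ∨-idem x

  ≤-reflexive : ∀ {x y} → x ≡ y → x ≤ y
  ≤-reflexive refl = ≤-refl

  ≤-antisym : ∀ {x y} → x ≤ y → y ≤ x → x ≡ y
  ≤-antisym {x} {y} x≤y y≤x = trans (sym y≤x) (trans (∨-comm y x) x≤y)

  x≤x∨y : ∀ {x y} → x ≤ x ∨ y
  x≤x∨y {x} {y} = trans (sym (∨-assoc x x y)) (cong (_∨ y) (∨-idem x))

  y≤x∨y : ∀ {x y} → y ≤ x ∨ y
  y≤x∨y {x} {y} = subst (y ≤_) (∨-comm y x) x≤x∨y

  ∨-least : ∀ {x y z} → x ≤ z → y ≤ z → x ∨ y ≤ z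
  ∨-least {x} {y} {z} x≤z y≤z = trans (∨-assoc x y z) (trans (cong (x ∨_) y≤z) x≤z)

  x≤y⇒x∧y≡x : ∀ {x y} → x ≤ y → x ∧ y ≡ x
  x≤y⇒x∧y≡x {x} {y} x≤y = trans (cong (x ∧_) (sym x≤y)) (∧-absorbs-∨ x y)

  x∧y≡x⇒x≤y : ∀ {x y} → x ∧ y ≡ x → x ≤ y
  x∧y≡x⇒x≤y {x} {y} x∧y≡x = begin
    x ∨ y       ≡⟨ cong (_∨ y) (sym x∧y≡x) ⟩
    (x ∧ y) ∨ y ≡⟨ ∨-comm (x ∧ y) y ⟩
    y ∨ (x ∧ y) ≡⟨ cong (y ∨_) (∧-comm x y) ⟩
    y ∨ (y ∧ x) ≡⟨ ∨-absorbs-∧ y x ⟩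
    y           ∎
    where open ≡-Reasoning

  x∧y≤x : ∀ {x y} → x ∧ y ≤ x
  x∧y≤x {x} {y} = x∧y≡x⇒x≤y (begin
    (x ∧ y) ∧ x ≡⟨ cong (_∧ x) (∧-comm x y) ⟩
    (y ∧ x) ∧ x ≡⟨ ∧-assoc y x x ⟩
    y ∧ (x ∧ x) ≡⟨ cong (y ∧_) (∧-idem x) ⟩
    y ∧ x       ≡⟨ ∧-comm y x ⟩
    x ∧ y       ∎)
    where open ≡-Reasoning

  x∧y≤y : ∀ {x y} → x ∧ y ≤ y
  x∧y≤y {x} {y} = subst (_≤ y) (∧-comm y x) x∧y≤x

  ∧-greatest : ∀ {x y z} → z ≤ x → z ≤ y → z ≤ x ∧ y
  ∧-greatest {x} {y} {z} z≤x z≤y = x∧y≡x⇒x≤y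
    (trans (sym (∧-assoc z x y)) (trans (cong (_∧ y) (x≤y⇒x∧y≡x z≤x)) (x≤y⇒x∧y≡x z≤y)))

  ∨-mono-≤ : ∀ {x x′ y y′} → x ≤ x′ → y ≤ y′ → x ∨ y ≤ x′ ∨ y′
  ∨-mono-≤ x≤x′ y≤y′ = ∨-least (x≤x′ ⟨≤⟩ x≤x∨y) (y≤y′ ⟨≤⟩ y≤x∨y)

  ∧-mono-≤ : ∀ {x x′ y y′} → x ≤ x′ → y ≤ y′ → x ∧ y ≤ x′ ∧ y′
  ∧-mono-≤ x≤x′ y≤y′ = ∧-greatest (x∧y≤x ⟨≤⟩ x≤x′) (x∧y≤y ⟨≤⟩ y≤y′)

  𝟎≤x : ∀ {x} → 𝟎 ≤ x
  𝟎≤x {x} = trans (∨-comm 𝟎 x) (∨-identityʳ x)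

  x≤𝟏 : ∀ {x} → x ≤ 𝟏
  x≤𝟏 {x} = begin
    x ∨ 𝟏       ≡⟨ cong (_∨ 𝟏) (sym (trans (∧-comm 𝟏 x) (∧-identityʳ x))) ⟩
    (𝟏 ∧ x) ∨ 𝟏 ≡⟨ ∨-comm (𝟏 ∧ x) 𝟏 ⟩
    𝟏 ∨ (𝟏 ∧ x) ≡⟨ ∨-absorbs-∧ 𝟏 x ⟩
    𝟏           ∎
    where open ≡-Reasoning

  x≤𝟎⇒x≡𝟎 : ∀ {x} → x ≤ 𝟎 → x ≡ 𝟎
  x≤𝟎⇒x≡𝟎 x≤𝟎 = ≤-antisym x≤𝟎 𝟎≤x

  ∧-distribˡ-∨-≤ : ∀ {x y z} → x ∧ (y ∨ z) ≤ (x ∧ y) ∨ (x ∧ z)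
  ∧-distribˡ-∨-≤ {x} {y} {z} = ≤-reflexive (∧-distribˡ-∨ x y z)

  ∧-distribʳ-∨-≤ : ∀ {x y z} → (y ∨ z) ∧ x ≤ (y ∧ x) ∨ (z ∧ x)
  ∧-distribʳ-∨-≤ {x} {y} {z} = ≤-reflexive (begin
    (y ∨ z) ∧ x       ≡⟨ ∧-comm (y ∨ z) x ⟩
    x ∧ (y ∨ z)       ≡⟨ ∧-distribˡ-∨ x y z ⟩
    (x ∧ y) ∨ (x ∧ z) ≡⟨ cong₂ _∨_ (∧-comm x y) (∧-comm x z) ⟩
    (y ∧ x) ∨ (z ∧ x) ∎)
    where open ≡-Reasoning

  ∨-distribʳ-∧-≤ : ∀ {x y z} → (y ∨ x) ∧ (z ∨ x) ≤ (y ∧ z) ∨ x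
  ∨-distribʳ-∧-≤ = ∧-distribʳ-∨-≤ ⟨≤⟩ ∨-least
    (∧-distribˡ-∨-≤ ⟨≤⟩ ∨-least x≤x∨y (x∧y≤y ⟨≤⟩ y≤x∨y))
    (x∧y≤x ⟨≤⟩ y≤x∨y)

  ∨-distribˡ-∧-≤ : ∀ {x y z} → (x ∨ y) ∧ (x ∨ z) ≤ x ∨ (y ∧ z)
  ∨-distribˡ-∧-≤ = ∧-distribʳ-∨-≤ ⟨≤⟩ ∨-least
    (x∧y≤x ⟨≤⟩ x≤x∨y)
    (∧-distribˡ-∨-≤ ⟨≤⟩ ∨-least (x∧y≤y ⟨≤⟩ x≤x∨y) y≤x∨y)

  x≤y∨z⇒x≤x∧y∨z : ∀ {x y z} → x ≤ y ∨ z → x ≤ (x ∧ y) ∨ z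
  x≤y∨z⇒x≤x∧y∨z x≤y∨z = ∧-greatest ≤-refl x≤y∨z ⟨≤⟩ ∧-distribˡ-∨-≤ ⟨≤⟩ ∨-mono-≤ ≤-refl x∧y≤y

  ∧-∨-least : ∀ {x y t u} → x ∧ t ≤ u → y ∧ t ≤ u → (x ∨ y) ∧ t ≤ u
  ∧-∨-least x∧t≤u y∧t≤u = ∧-distribʳ-∨-≤ ⟨≤⟩ ∨-least x∧t≤u y∧t≤u

  −-covers′ : ∀ {x y} → x ≤ y ∨ (x - y)
  −-covers′ {x} {y} = −-covers x y

  −-least′ : ∀ {x y z} → x ≤ y ∨ z → x - y ≤ z
  −-least′ {x} {y} {z} = −-least x y z

  −-monoˡ-≤ : ∀ {x x′ y} → x ≤ x′ → x - y ≤ x′ - y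
  −-monoˡ-≤ x≤x′ = −-least′ (x≤x′ ⟨≤⟩ −-covers′)

  −-antimonoʳ-≤ : ∀ {x y y′} → y ≤ y′ → x - y′ ≤ x - y
  −-antimonoʳ-≤ y≤y′ = −-least′ (−-covers′ ⟨≤⟩ ∨-mono-≤ y≤y′ ≤-refl)

  x-y≤x : ∀ {x y} → x - y ≤ x
  x-y≤x = −-least′ y≤x∨y

  x≤y⇒x-y≤𝟎 : ∀ {x y} → x ≤ y → x - y ≤ 𝟎
  x≤y⇒x-y≤𝟎 x≤y = −-least′ (x≤y ⟨≤⟩ x≤x∨y)

  x-[y∧x]≤x-y : ∀ {x y} → x - (y ∧ x) ≤ x - y
  x-[y∧x]≤x-y {x} {y} =
    −-least′ (x≤y∨z⇒x≤x∧y∨z −-covers′ ⟨≤⟩ ∨-mono-≤ (≤-reflexive (∧-comm x y)) ≤-refl)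

  −-distribʳ-∨-≤ : ∀ {x x′ y} → (x ∨ x′) - y ≤ (x - y) ∨ (x′ - y)
  −-distribʳ-∨-≤ = −-least′ (∨-least (−-covers′ ⟨≤⟩ ∨-mono-≤ ≤-refl x≤x∨y)
                                     (−-covers′ ⟨≤⟩ ∨-mono-≤ ≤-refl y≤x∨y))

  x≤y∨z⇒x-y≤z-w : ∀ {x y z w} → x ≤ y ∨ z → w ≤ y → x - y ≤ z - w
  x≤y∨z⇒x-y≤z-w x≤y∨z w≤y =
    −-least′ (x≤y∨z ⟨≤⟩ ∨-mono-≤ ≤-refl −-covers′ ⟨≤⟩ ∨-least x≤x∨y (∨-least (w≤y ⟨≤⟩ x≤x∨y) y≤x∨y))

  −-∧-bound-∨ : ∀ {x x′ y t u u′} → (x - y) ∧ t ≤ u → (x′ - y) ∧ t ≤ u′ → ((x ∨ x′) - y) ∧ t ≤ u ∨ u′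
  −-∧-bound-∨ h h′ = ∧-mono-≤ −-distribʳ-∨-≤ ≤-refl ⟨≤⟩ ∧-distribʳ-∨-≤ ⟨≤⟩ ∨-mono-≤ h h′

  −-∧-bound-∧ : ∀ {x x′ y t u u′} → (x - y) ∧ t ≤ u → (x′ - y) ∧ t ≤ u′ → ((x ∧ x′) - y) ∧ t ≤ u ∧ u′
  −-∧-bound-∧ h h′ = ∧-greatest (∧-mono-≤ (−-monoˡ-≤ x∧y≤x) ≤-refl ⟨≤⟩ h)
                                (∧-mono-≤ (−-monoˡ-≤ x∧y≤y) ≤-refl ⟨≤⟩ h′)

  x∨∼x : ∀ {x} → 𝟏 ≤ x ∨ ∼ x
  x∨∼x = −-covers′

  ∼∼x≤x : ∀ {x} → ∼ ∼ x ≤ x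
  ∼∼x≤x {x} = −-least′ (x∨∼x ⟨≤⟩ ≤-reflexive (∨-comm x (∼ x)))

  𝟏≤y∨z⇒x≤x∧y∨x∧z : ∀ {x y z} → 𝟏 ≤ y ∨ z → x ≤ (x ∧ y) ∨ (x ∧ z)
  𝟏≤y∨z⇒x≤x∧y∨x∧z 𝟏≤y∨z = ∧-greatest ≤-refl (x≤𝟏 ⟨≤⟩ 𝟏≤y∨z) ⟨≤⟩ ∧-distribˡ-∨-≤

  x∧∼y≤𝟎⇒x≤y : ∀ {x y} → x ∧ ∼ y ≤ 𝟎 → x ≤ y
  x∧∼y≤𝟎⇒x≤y x∧∼y≤𝟎 = 𝟏≤y∨z⇒x≤x∧y∨x∧z x∨∼x ⟨≤⟩ ∨-least x∧y≤y (x∧∼y≤𝟎 ⟨≤⟩ 𝟎≤x)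

  x∧y≤𝟎⇒x≤∼y : ∀ {x y} → x ∧ y ≤ 𝟎 → x ≤ ∼ y
  x∧y≤𝟎⇒x≤∼y x∧y≤𝟎 = 𝟏≤y∨z⇒x≤x∧y∨x∧z x∨∼x ⟨≤⟩ ∨-least (x∧y≤𝟎 ⟨≤⟩ 𝟎≤x) x∧y≤y

  Complemented : Carrier → Set
  Complemented x = x ∧ ∼ x ≤ 𝟎

  complemented-∧ : ∀ {x y} → Complemented x → Complemented y → Complemented (x ∧ y)
  complemented-∧ {x} {y} cx cy = ∧-mono-≤ ≤-refl ∼[x∧y]≤∼x∨∼y ⟨≤⟩ ∧-distribˡ-∨-≤ ⟨≤⟩ ∨-least
      (∧-mono-≤ x∧y≤x ≤-refl ⟨≤⟩ cx) (∧-mono-≤ x∧y≤y ≤-refl ⟨≤⟩ cy)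
    where
      ∼[x∧y]≤∼x∨∼y : ∼ (x ∧ y) ≤ ∼ x ∨ ∼ y
      ∼[x∧y]≤∼x∨∼y = −-least′ (∧-greatest (x∨∼x {x}) (x∨∼x {y}) ⟨≤⟩ ∧-distribʳ-∨-≤ ⟨≤⟩ ∨-least
        (∧-distribˡ-∨-≤ ⟨≤⟩ ∨-least x≤x∨y (x∧y≤y ⟨≤⟩ y≤x∨y ⟨≤⟩ y≤x∨y))
        (x∧y≤x ⟨≤⟩ x≤x∨y ⟨≤⟩ y≤x∨y))

  complemented-∧-−-≤ : ∀ {x y z} → Complemented x → x ∧ (y - z) ≤ (x ∧ y) - z
  complemented-∧-−-≤ {x} {y} {z} cx = ∧-mono-≤ ≤-refl y-z≤[x∧y-z]∨∼x ⟨≤⟩ ∧-distribˡ-∨-≤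
      ⟨≤⟩ ∨-least x∧y≤y (cx ⟨≤⟩ 𝟎≤x)
    where
      y-z≤[x∧y-z]∨∼x : y - z ≤ ((x ∧ y) - z) ∨ ∼ x
      y-z≤[x∧y-z]∨∼x = −-least′ (𝟏≤y∨z⇒x≤x∧y∨x∧z x∨∼x ⟨≤⟩ ∨-least
        (≤-reflexive (∧-comm y x) ⟨≤⟩ −-covers′ ⟨≤⟩ ∨-mono-≤ ≤-refl x≤x∨y)
        (x∧y≤y ⟨≤⟩ y≤x∨y ⟨≤⟩ y≤x∨y))

  complemented-∧-−-≤𝟎 : ∀ {x y z} → Complemented x → x ∧ y ≤ z → x ∧ (y - z) ≤ 𝟎
  complemented-∧-−-≤𝟎 cx x∧y≤z = complemented-∧-−-≤ cx ⟨≤⟩ x≤y⇒x-y≤𝟎 x∧y≤z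

  complemented-∧∼≤− : ∀ {x y} → Complemented x → x ∧ ∼ y ≤ x - y
  complemented-∧∼≤− cx = complemented-∧-−-≤ cx ⟨≤⟩ −-monoˡ-≤ x∧y≤x

module Extension (L : CoHeyting) {a b₁ b₂ : CoHeyting.Carrier L}
                 (b₁≤a : CoHeyting._≤_ L b₁ a) (b₂≤a : CoHeyting._≤_ L b₂ a) where
  open CoHeyting L hiding (_≤_)
  open CoHeytingProperties L

  c : Carrier
  c = b₁ ∧ b₂

  c≤a : c ≤ a
  c≤a = x∧y≤x ⟨≤⟩ b₁≤a

  record Quad : Set where
    constructor quad
    field
      r y₁ y₂ z   : Carrier
      a≤r         : a ≤ r
      b₂≤y₁       : b₂ ≤ y₁
      y₁≤a        : y₁ ≤ a
      b₁≤y₂       : b₁ ≤ y₂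
      y₂≤a        : y₂ ≤ a
      z≤c         : z ≤ c
      [r-a]∧a≤y₁  : (r - a) ∧ a ≤ y₁
      [r-a]∧a≤y₂  : (r - a) ∧ a ≤ y₂
      [r-a]∧c≤z   : (r - a) ∧ c ≤ z
      [y₁-b₂]∧c≤z : (y₁ - b₂) ∧ c ≤ z
      [y₂-b₁]∧c≤z : (y₂ - b₁) ∧ c ≤ z
  open Quad

  Quad-≡ : ∀ X Y → r X ≡ r Y → y₁ X ≡ y₁ Y → y₂ X ≡ y₂ Y → z X ≡ z Y → X ≡ Y
  Quad-≡ (quad r y₁ y₂ z p₁ p₂ p₃ p₄ p₅ p₆ p₇ p₈ p₉ p₁₀ p₁₁)
         (quad _ _ _ _ q₁ q₂ q₃ q₄ q₅ q₆ q₇ q₈ q₉ q₁₀ q₁₁) refl refl refl refl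
    with uip p₁ q₁ | uip p₂ q₂ | uip p₃ q₃ | uip p₄ q₄ | uip p₅ q₅ | uip p₆ q₆
       | uip p₇ q₇ | uip p₈ q₈ | uip p₉ q₉ | uip p₁₀ q₁₀ | uip p₁₁ q₁₁
  ... | refl | refl | refl | refl | refl | refl | refl | refl | refl | refl | refl = refl

  𝟎′ : Quad
  𝟎′ = quad a b₂ b₁ 𝟎 ≤-refl ≤-refl b₂≤a ≤-refl b₁≤a 𝟎≤x
    (x∧y≤x ⟨≤⟩ x≤y⇒x-y≤𝟎 ≤-refl ⟨≤⟩ 𝟎≤x) (x∧y≤x ⟨≤⟩ x≤y⇒x-y≤𝟎 ≤-refl ⟨≤⟩ 𝟎≤x)
    (x∧y≤x ⟨≤⟩ x≤y⇒x-y≤𝟎 ≤-refl) (x∧y≤x ⟨≤⟩ x≤y⇒x-y≤𝟎 ≤-refl) (x∧y≤x ⟨≤⟩ x≤y⇒x-y≤𝟎 ≤-refl)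

  𝟏′ : Quad
  𝟏′ = quad 𝟏 a a c x≤𝟏 b₂≤a ≤-refl b₁≤a ≤-refl ≤-refl x∧y≤y x∧y≤y x∧y≤y x∧y≤y x∧y≤y

  infixr 6 _∨′_
  _∨′_ : Quad → Quad → Quad
  X ∨′ Y = quad (r X ∨ r Y) (y₁ X ∨ y₁ Y) (y₂ X ∨ y₂ Y) (z X ∨ z Y)
    (a≤r X ⟨≤⟩ x≤x∨y) (b₂≤y₁ X ⟨≤⟩ x≤x∨y) (∨-least (y₁≤a X) (y₁≤a Y))
    (b₁≤y₂ X ⟨≤⟩ x≤x∨y) (∨-least (y₂≤a X) (y₂≤a Y)) (∨-least (z≤c X) (z≤c Y))
    (−-∧-bound-∨ ([r-a]∧a≤y₁ X) ([r-a]∧a≤y₁ Y)) (−-∧-bound-∨ ([r-a]∧a≤y₂ X) ([r-a]∧a≤y₂ Y))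
    (−-∧-bound-∨ ([r-a]∧c≤z X) ([r-a]∧c≤z Y))
    (−-∧-bound-∨ ([y₁-b₂]∧c≤z X) ([y₁-b₂]∧c≤z Y)) (−-∧-bound-∨ ([y₂-b₁]∧c≤z X) ([y₂-b₁]∧c≤z Y))

  infixr 7 _∧′_
  _∧′_ : Quad → Quad → Quad
  X ∧′ Y = quad (r X ∧ r Y) (y₁ X ∧ y₁ Y) (y₂ X ∧ y₂ Y) (z X ∧ z Y)
    (∧-greatest (a≤r X) (a≤r Y)) (∧-greatest (b₂≤y₁ X) (b₂≤y₁ Y)) (x∧y≤x ⟨≤⟩ y₁≤a X)
    (∧-greatest (b₁≤y₂ X) (b₁≤y₂ Y)) (x∧y≤x ⟨≤⟩ y₂≤a X) (x∧y≤x ⟨≤⟩ z≤c X)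
    (−-∧-bound-∧ ([r-a]∧a≤y₁ X) ([r-a]∧a≤y₁ Y)) (−-∧-bound-∧ ([r-a]∧a≤y₂ X) ([r-a]∧a≤y₂ Y))
    (−-∧-bound-∧ ([r-a]∧c≤z X) ([r-a]∧c≤z Y))
    (−-∧-bound-∧ ([y₁-b₂]∧c≤z X) ([y₁-b₂]∧c≤z Y)) (−-∧-bound-∧ ([y₂-b₁]∧c≤z X) ([y₂-b₁]∧c≤z Y))

  -- The coordinatewise differences, enlarged just enough to restore the compatibility inequalities.
  infixl 8 _-′_
  _-′_ : Quad → Quad → Quad
  X -′ Y = quad R Y₁ Y₂ Z y≤x∨y (y≤x∨y ⟨≤⟩ y≤x∨y)
      (∨-least x∧y≤y (∨-least (x-y≤x ⟨≤⟩ y₁≤a X) b₂≤a)) (y≤x∨y ⟨≤⟩ y≤x∨y)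
      (∨-least x∧y≤y (∨-least (x-y≤x ⟨≤⟩ y₂≤a X) b₁≤a)) x∧y≤y
      (∧-mono-≤ R-a≤d ≤-refl ⟨≤⟩ x≤x∨y) (∧-mono-≤ R-a≤d ≤-refl ⟨≤⟩ x≤x∨y)
      (∧-mono-≤ (R-a≤d ⟨≤⟩ x≤x∨y) ≤-refl)
      (∧-mono-≤ (−-least′ (∨-least (x∧y≤x ⟨≤⟩ x≤x∨y ⟨≤⟩ y≤x∨y)
                                   (∨-least (x≤x∨y ⟨≤⟩ y≤x∨y ⟨≤⟩ y≤x∨y) x≤x∨y))) ≤-refl)
      (∧-mono-≤ (−-least′ (∨-least (x∧y≤x ⟨≤⟩ x≤x∨y ⟨≤⟩ y≤x∨y)
                                   (∨-least (x≤x∨y ⟨≤⟩ y≤x∨y ⟨≤⟩ y≤x∨y ⟨≤⟩ y≤x∨y) x≤x∨y))) ≤-refl)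
    where
      d : Carrier
      d = r X - r Y
      R : Carrier
      R = d ∨ a
      Y₁ : Carrier
      Y₁ = (d ∧ a) ∨ (y₁ X - y₁ Y) ∨ b₂
      Y₂ : Carrier
      Y₂ = (d ∧ a) ∨ (y₂ X - y₂ Y) ∨ b₁
      Z : Carrier
      Z = (d ∨ (y₁ X - y₁ Y) ∨ (y₂ X - y₂ Y) ∨ (z X - z Y)) ∧ c
      R-a≤d : R - a ≤ d
      R-a≤d = −-least′ (∨-least y≤x∨y x≤x∨y)

  infix 4 _≤′_
  _≤′_ : Quad → Quad → Set
  X ≤′ Y = X ∨′ Y ≡ Y

  ≤′-intro : ∀ {X Y} → r X ≤ r Y → y₁ X ≤ y₁ Y → y₂ X ≤ y₂ Y → z X ≤ z Y → X ≤′ Y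
  ≤′-intro {X} {Y} = Quad-≡ (X ∨′ Y) Y

  −′-covers : ∀ X Y → X ≤′ Y ∨′ (X -′ Y)
  −′-covers X Y = ≤′-intro {X} {Y ∨′ (X -′ Y)}
    (−-covers′ ⟨≤⟩ ∨-mono-≤ ≤-refl x≤x∨y)
    (−-covers′ ⟨≤⟩ ∨-mono-≤ ≤-refl (x≤x∨y ⟨≤⟩ y≤x∨y))
    (−-covers′ ⟨≤⟩ ∨-mono-≤ ≤-refl (x≤x∨y ⟨≤⟩ y≤x∨y))
    (−-covers′ ⟨≤⟩ ∨-mono-≤ ≤-refl (∧-greatest (y≤x∨y ⟨≤⟩ y≤x∨y ⟨≤⟩ y≤x∨y) (x-y≤x ⟨≤⟩ z≤c X)))

  −′-least : ∀ X Y W → X ≤′ Y ∨′ W → X -′ Y ≤′ W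
  −′-least X Y W X≤Y∨W = ≤′-intro {X -′ Y} {W}
      (∨-least (−-least′ rX≤) (a≤r W))
      (∨-least (∧-mono-≤ r-diff ≤-refl ⟨≤⟩ [r-a]∧a≤y₁ W) (∨-least (−-least′ y₁X≤) (b₂≤y₁ W)))
      (∨-least (∧-mono-≤ r-diff ≤-refl ⟨≤⟩ [r-a]∧a≤y₂ W) (∨-least (−-least′ y₂X≤) (b₁≤y₂ W)))
      (∧-∨-least (∧-mono-≤ r-diff ≤-refl ⟨≤⟩ [r-a]∧c≤z W)
        (∧-∨-least (∧-mono-≤ (x≤y∨z⇒x-y≤z-w y₁X≤ (b₂≤y₁ Y)) ≤-refl ⟨≤⟩ [y₁-b₂]∧c≤z W)
          (∧-∨-least (∧-mono-≤ (x≤y∨z⇒x-y≤z-w y₂X≤ (b₁≤y₂ Y)) ≤-refl ⟨≤⟩ [y₂-b₁]∧c≤z W)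
            (x∧y≤x ⟨≤⟩ −-least′ (cong z X≤Y∨W)))))
    where
      rX≤ : r X ≤ r Y ∨ r W
      rX≤ = cong r X≤Y∨W
      y₁X≤ : y₁ X ≤ y₁ Y ∨ y₁ W
      y₁X≤ = cong y₁ X≤Y∨W
      y₂X≤ : y₂ X ≤ y₂ Y ∨ y₂ W
      y₂X≤ = cong y₂ X≤Y∨W
      r-diff : r X - r Y ≤ r W - a
      r-diff = x≤y∨z⇒x-y≤z-w rX≤ (a≤r Y)

  L′ : CoHeyting
  L′ = record
    { Carrier = Quad ; 𝟎 = 𝟎′ ; 𝟏 = 𝟏′ ; _∨_ = _∨′_ ; _∧_ = _∧′_ ; _-_ = _-′_
    ; ∨-assoc = λ X Y W → Quad-≡ ((X ∨′ Y) ∨′ W) (X ∨′ Y ∨′ W)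
        (∨-assoc _ _ _) (∨-assoc _ _ _) (∨-assoc _ _ _) (∨-assoc _ _ _)
    ; ∧-assoc = λ X Y W → Quad-≡ ((X ∧′ Y) ∧′ W) (X ∧′ Y ∧′ W)
        (∧-assoc _ _ _) (∧-assoc _ _ _) (∧-assoc _ _ _) (∧-assoc _ _ _)
    ; ∨-comm = λ X Y → Quad-≡ (X ∨′ Y) (Y ∨′ X) (∨-comm _ _) (∨-comm _ _) (∨-comm _ _) (∨-comm _ _)
    ; ∧-comm = λ X Y → Quad-≡ (X ∧′ Y) (Y ∧′ X) (∧-comm _ _) (∧-comm _ _) (∧-comm _ _) (∧-comm _ _)
    ; ∨-absorbs-∧ = λ X Y → Quad-≡ (X ∨′ X ∧′ Y) X
        (∨-absorbs-∧ _ _) (∨-absorbs-∧ _ _) (∨-absorbs-∧ _ _) (∨-absorbs-∧ _ _)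
    ; ∧-absorbs-∨ = λ X Y → Quad-≡ (X ∧′ (X ∨′ Y)) X
        (∧-absorbs-∨ _ _) (∧-absorbs-∨ _ _) (∧-absorbs-∨ _ _) (∧-absorbs-∨ _ _)
    ; ∧-distribˡ-∨ = λ X Y W → Quad-≡ (X ∧′ (Y ∨′ W)) (X ∧′ Y ∨′ X ∧′ W)
        (∧-distribˡ-∨ _ _ _) (∧-distribˡ-∨ _ _ _) (∧-distribˡ-∨ _ _ _) (∧-distribˡ-∨ _ _ _)
    ; ∨-identityʳ = λ X → Quad-≡ (X ∨′ 𝟎′) X
        (trans (∨-comm _ _) (a≤r X)) (trans (∨-comm _ _) (b₂≤y₁ X))
        (trans (∨-comm _ _) (b₁≤y₂ X)) (∨-identityʳ _)
    ; ∧-identityʳ = λ X → Quad-≡ (X ∧′ 𝟏′) X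
        (∧-identityʳ _) (x≤y⇒x∧y≡x (y₁≤a X)) (x≤y⇒x∧y≡x (y₂≤a X)) (x≤y⇒x∧y≡x (z≤c X))
    ; −-covers = −′-covers
    ; −-least = −′-least
    }

  -- Each coordinate of ∼X ∧ ∼∼X (computed in L′) lies below its least value joined with ∼x ∧ ∼∼x,
  -- where x is r in the first and last coordinates and y ∨ (r - a) in the middle ones.
  module _ (v₂ : InV₂ L) (c≤∼a : c ≤ ∼ a) where
    ∼-complemented : ∀ x → Complemented (∼ x)
    ∼-complemented x = ≤-reflexive (v₂ x)

    r-coordinate : ∀ {r} → (∼ r ∨ a) ∧ (∼ (∼ r ∨ a) ∨ a) ≡ a
    r-coordinate {r} = ≤-antisym
      (∨-distribʳ-∧-≤ ⟨≤⟩ ∨-least (∧-mono-≤ ≤-refl (−-antimonoʳ-≤ x≤x∨y) ⟨≤⟩ ∼-complemented r ⟨≤⟩ 𝟎≤x) ≤-refl)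
      (∧-greatest y≤x∨y y≤x∨y)

    y-coordinate : ∀ {r y b} → a ≤ r → y ≤ a → (r - a) ∧ a ≤ y → b ≤ a →
      let y′ = (∼ r ∧ a) ∨ (a - y) ∨ b in
      y′ ∧ ((∼ (∼ r ∨ a) ∧ a) ∨ (a - y′) ∨ b) ≡ b
    y-coordinate {r} {y} {b} a≤r y≤a [r-a]∧a≤y b≤a = ≤-antisym
        (∧-mono-≤ (reassoc ⟨≤⟩ ∨-mono-≤ ≤∼x ≤-refl) (reassoc ⟨≤⟩ ∨-mono-≤ ≤∼∼x ≤-refl)
          ⟨≤⟩ ∨-distribʳ-∧-≤ ⟨≤⟩ ∨-least (∼-complemented x ⟨≤⟩ 𝟎≤x) ≤-refl)
        (∧-greatest (y≤x∨y ⟨≤⟩ y≤x∨y) (y≤x∨y ⟨≤⟩ y≤x∨y))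
      where
        x : Carrier
        x = y ∨ (r - a)
        y′ : Carrier
        y′ = (∼ r ∧ a) ∨ (a - y) ∨ b

        reassoc : ∀ {p q} → p ∨ q ∨ b ≤ (p ∨ q) ∨ b
        reassoc = ∨-least (x≤x∨y ⟨≤⟩ x≤x∨y) (∨-least (y≤x∨y ⟨≤⟩ x≤x∨y) y≤x∨y)

        ≤∼x : (∼ r ∧ a) ∨ (a - y) ≤ ∼ x
        ≤∼x = ∨-least (x∧y≤x ⟨≤⟩ −-antimonoʳ-≤ (∨-least (y≤a ⟨≤⟩ a≤r) x-y≤x))
          (−-least′ (𝟏≤y∨z⇒x≤x∧y∨x∧z (x∨∼x {x}) ⟨≤⟩ ∨-mono-≤
            (∧-distribˡ-∨-≤ ⟨≤⟩ ∨-least x∧y≤y (≤-reflexive (∧-comm a (r - a)) ⟨≤⟩ [r-a]∧a≤y))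
            x∧y≤y))

        ∼x≤∼r∨a : ∼ x ≤ ∼ r ∨ a
        ∼x≤∼r∨a = −-least′ (x∨∼x {r} ⟨≤⟩ ∨-least
          (−-covers′ ⟨≤⟩ ∨-least (y≤x∨y ⟨≤⟩ y≤x∨y) (y≤x∨y ⟨≤⟩ x≤x∨y))
          (x≤x∨y ⟨≤⟩ y≤x∨y))

        ∼x∧a≤y′ : ∼ x ∧ a ≤ y′
        ∼x∧a≤y′ = ∧-mono-≤ ∼x≤∼r∨[a-y] ≤-refl ⟨≤⟩ ∧-distribʳ-∨-≤ ⟨≤⟩ ∨-mono-≤ ≤-refl (x∧y≤x ⟨≤⟩ x≤x∨y)
          where
            ∼x≤∼r∨[a-y] : ∼ x ≤ ∼ r ∨ (a - y)
            ∼x≤∼r∨[a-y] = −-least′ (x∨∼x {r} ⟨≤⟩ ∨-least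
              (−-covers′ ⟨≤⟩ ∨-least (−-covers′ ⟨≤⟩ ∨-least (x≤x∨y ⟨≤⟩ x≤x∨y) (y≤x∨y ⟨≤⟩ y≤x∨y))
                                     (y≤x∨y ⟨≤⟩ x≤x∨y))
              (x≤x∨y ⟨≤⟩ y≤x∨y))

        ≤∼∼x : (∼ (∼ r ∨ a) ∧ a) ∨ (a - y′) ≤ ∼ ∼ x
        ≤∼∼x = ∨-least (x∧y≤x ⟨≤⟩ −-antimonoʳ-≤ ∼x≤∼r∨a)
                       (−-antimonoʳ-≤ ∼x∧a≤y′ ⟨≤⟩ x-[y∧x]≤x-y ⟨≤⟩ −-monoˡ-≤ x≤𝟏)

    disjoint-via-∼a : ∀ {s t} → (s ∧ ∼ a) ∧ t ≤ 𝟎 → (t ∧ c) ∧ s ≤ 𝟎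
    disjoint-via-∼a h =
      ∧-greatest (∧-greatest x∧y≤y (x∧y≤x ⟨≤⟩ x∧y≤y ⟨≤⟩ c≤∼a)) (x∧y≤x ⟨≤⟩ x∧y≤x) ⟨≤⟩ h

    z-∼≤∼r : ∀ X → z (𝟏′ -′ X) ≤ ∼ r X
    z-∼≤∼r X = ∧-∨-least
        (below-∼r (∧-mono-≤ x∧y≤x ≤-refl ⟨≤⟩ ≤-reflexive (∧-comm (∼ ∼ r X) (∼ r X))
                     ⟨≤⟩ ∼-complemented (r X)))
        (∧-∨-least (below-∼r (k∧[a-y]≤𝟎 ([r-a]∧a≤y₁ X)))
          (∧-∨-least (below-∼r (k∧[a-y]≤𝟎 ([r-a]∧a≤y₂ X)))
                     (below-∼r (complemented-∧-−-≤𝟎 k-complemented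
                                  (∧-mono-≤ k≤r-a ≤-refl ⟨≤⟩ [r-a]∧c≤z X)))))
      where
        k : Carrier
        k = ∼ ∼ r X ∧ ∼ a
        k-complemented : Complemented k
        k-complemented = complemented-∧ (∼-complemented (∼ r X)) (∼-complemented a)

        k≤r-a : k ≤ r X - a
        k≤r-a = complemented-∧∼≤− (∼-complemented (∼ r X)) ⟨≤⟩ −-monoˡ-≤ ∼∼x≤x

        k∧[a-y]≤𝟎 : ∀ {y} → (r X - a) ∧ a ≤ y → k ∧ (a - y) ≤ 𝟎
        k∧[a-y]≤𝟎 [r-a]∧a≤y = complemented-∧-−-≤𝟎 k-complemented (∧-mono-≤ k≤r-a ≤-refl ⟨≤⟩ [r-a]∧a≤y)

        below-∼r : ∀ {t} → k ∧ t ≤ 𝟎 → t ∧ c ≤ ∼ r X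
        below-∼r h = x∧∼y≤𝟎⇒x≤y (disjoint-via-∼a h)

    z-∼∼≤∼∼r : ∀ X → z (𝟏′ -′ (𝟏′ -′ X)) ≤ ∼ ∼ r X
    z-∼∼≤∼∼r X = ∧-∨-least (x∧y≤x ⟨≤⟩ −-antimonoʳ-≤ x≤x∨y)
        (∧-∨-least (below-∼∼r (k∧[p-q]≤𝟎 (∧-mono-≤ x∧y≤x ≤-refl ⟨≤⟩ x≤x∨y)))
          (∧-∨-least (below-∼∼r (k∧[p-q]≤𝟎 (∧-mono-≤ x∧y≤x ≤-refl ⟨≤⟩ x≤x∨y)))
                     (below-∼∼r (k∧[p-q]≤𝟎 (∧-greatest (x∧y≤x ⟨≤⟩ x∧y≤x ⟨≤⟩ x≤x∨y) x∧y≤y)))))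
      where
        k : Carrier
        k = ∼ r X ∧ ∼ a

        k∧[p-q]≤𝟎 : ∀ {p q} → k ∧ p ≤ q → k ∧ (p - q) ≤ 𝟎
        k∧[p-q]≤𝟎 = complemented-∧-−-≤𝟎 (complemented-∧ (∼-complemented (r X)) (∼-complemented a))

        below-∼∼r : ∀ {t} → k ∧ t ≤ 𝟎 → t ∧ c ≤ ∼ ∼ r X
        below-∼∼r h = x∧y≤𝟎⇒x≤∼y (disjoint-via-∼a h)

    z-coordinate : ∀ X → z (𝟏′ -′ X) ∧ z (𝟏′ -′ (𝟏′ -′ X)) ≡ 𝟎
    z-coordinate X = x≤𝟎⇒x≡𝟎 (∧-mono-≤ (z-∼≤∼r X) (z-∼∼≤∼∼r X) ⟨≤⟩ ∼-complemented (r X))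

    L′-InV₂ : InV₂ L′
    L′-InV₂ X = Quad-≡ (𝟏′ -′ X ∧′ 𝟏′ -′ (𝟏′ -′ X)) 𝟎′ r-coordinate
      (y-coordinate (a≤r X) (y₁≤a X) ([r-a]∧a≤y₁ X) b₂≤a)
      (y-coordinate (a≤r X) (y₂≤a X) ([r-a]∧a≤y₂ X) b₁≤a)
      (z-coordinate X)

  ι : Carrier → Quad
  ι x = quad (x ∨ a) ((x ∧ a) ∨ b₂) ((x ∧ a) ∨ b₁) (x ∧ c)
      y≤x∨y y≤x∨y (∨-least x∧y≤y b₂≤a) y≤x∨y (∨-least x∧y≤y b₁≤a) x∧y≤y
      (∧-mono-≤ [x∨a]-a≤x ≤-refl ⟨≤⟩ x≤x∨y) (∧-mono-≤ [x∨a]-a≤x ≤-refl ⟨≤⟩ x≤x∨y)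
      (∧-mono-≤ [x∨a]-a≤x ≤-refl)
      (∧-mono-≤ (−-least′ (∨-least y≤x∨y x≤x∨y) ⟨≤⟩ x∧y≤x) ≤-refl)
      (∧-mono-≤ (−-least′ (∨-least y≤x∨y x≤x∨y) ⟨≤⟩ x∧y≤x) ≤-refl)
    where
      [x∨a]-a≤x : (x ∨ a) - a ≤ x
      [x∨a]-a≤x = −-least′ (∨-least y≤x∨y x≤x∨y)

  module ι-− (x y : Carrier) where
    Δr : Carrier
    Δr = (x ∨ a) - (y ∨ a)
    Δy : Carrier → Carrier
    Δy b = ((x ∧ a) ∨ b) - ((y ∧ a) ∨ b)
    Δz : Carrier
    Δz = (x ∧ c) - (y ∧ c)

    Δr≤x-y : Δr ≤ x - y
    Δr≤x-y = −-least′ (∨-least (−-covers′ ⟨≤⟩ ∨-mono-≤ x≤x∨y ≤-refl) (y≤x∨y ⟨≤⟩ x≤x∨y))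

    Δy≤x-y : ∀ {b} → Δy b ≤ x - y
    Δy≤x-y = −-least′ (∨-least
      (∧-mono-≤ −-covers′ ≤-refl ⟨≤⟩ ∧-distribʳ-∨-≤ ⟨≤⟩ ∨-least (x≤x∨y ⟨≤⟩ x≤x∨y) (x∧y≤x ⟨≤⟩ y≤x∨y))
      (y≤x∨y ⟨≤⟩ x≤x∨y))

    Δz≤x-y : Δz ≤ x - y
    Δz≤x-y = −-least′ (∧-mono-≤ −-covers′ ≤-refl ⟨≤⟩ ∧-distribʳ-∨-≤ ⟨≤⟩ ∨-mono-≤ ≤-refl x∧y≤x)

    x≤x∧a∨y∨Δr : x ≤ (x ∧ a) ∨ y ∨ Δr
    x≤x∧a∨y∨Δr = x≤y∨z⇒x≤x∧y∨z (x≤x∨y ⟨≤⟩ −-covers′ ⟨≤⟩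
      ∨-least (∨-least (x≤x∨y ⟨≤⟩ y≤x∨y) x≤x∨y) (y≤x∨y ⟨≤⟩ y≤x∨y))

    x∧a≤y∨Δy∨b : ∀ {b} → x ∧ a ≤ (y ∨ Δy b) ∨ b
    x∧a≤y∨Δy∨b = x≤x∨y ⟨≤⟩ −-covers′ ⟨≤⟩
      ∨-least (∨-least (x∧y≤x ⟨≤⟩ x≤x∨y ⟨≤⟩ x≤x∨y) y≤x∨y) (y≤x∨y ⟨≤⟩ x≤x∨y)

    x-y≤Δr∨Δy∨b : ∀ {b} → x - y ≤ Δr ∨ Δy b ∨ b
    x-y≤Δr∨Δy∨b = −-least′ (x≤x∧a∨y∨Δr ⟨≤⟩ ∨-least
      (x∧a≤y∨Δy∨b ⟨≤⟩ ∨-least (∨-least x≤x∨y (x≤x∨y ⟨≤⟩ y≤x∨y ⟨≤⟩ y≤x∨y)) (y≤x∨y ⟨≤⟩ y≤x∨y ⟨≤⟩ y≤x∨y))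
      (∨-least x≤x∨y (x≤x∨y ⟨≤⟩ y≤x∨y)))

    x-y≤Δr∨Δy₂∨Δy₁∨Δz : x - y ≤ Δr ∨ Δy b₂ ∨ Δy b₁ ∨ Δz
    x-y≤Δr∨Δy₂∨Δy₁∨Δz = −-least′ (x≤x∧a∨y∨Δr ⟨≤⟩ ∨-least x∧a≤ (∨-least x≤x∨y (x≤x∨y ⟨≤⟩ y≤x∨y)))
      where
        x∧a≤ : x ∧ a ≤ y ∨ Δr ∨ Δy b₂ ∨ Δy b₁ ∨ Δz
        x∧a≤ = ∧-greatest x∧y≤x
          (∧-greatest
            (x∧a≤y∨Δy∨b ⟨≤⟩ ∨-mono-≤ (∨-least x≤x∨y (x≤x∨y ⟨≤⟩ y≤x∨y ⟨≤⟩ y≤x∨y ⟨≤⟩ y≤x∨y)) ≤-refl)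
            (x∧a≤y∨Δy∨b ⟨≤⟩ ∨-mono-≤ (∨-least x≤x∨y (x≤x∨y ⟨≤⟩ y≤x∨y ⟨≤⟩ y≤x∨y)) ≤-refl)
            ⟨≤⟩ ∨-distribˡ-∧-≤)
          ⟨≤⟩ ∧-distribˡ-∨-≤
          ⟨≤⟩ ∨-least x∧y≤y (−-covers′ ⟨≤⟩ ∨-least (x∧y≤x ⟨≤⟩ x≤x∨y) (y≤x∨y ⟨≤⟩ y≤x∨y ⟨≤⟩ y≤x∨y ⟨≤⟩ y≤x∨y))

    r-ι-− : (x - y) ∨ a ≡ Δr ∨ a
    r-ι-− = ≤-antisym
      (∨-least (−-least′ (x≤x∨y ⟨≤⟩ −-covers′ ⟨≤⟩ ∨-least (∨-least x≤x∨y (y≤x∨y ⟨≤⟩ y≤x∨y)) (x≤x∨y ⟨≤⟩ y≤x∨y)))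
               y≤x∨y)
      (∨-mono-≤ Δr≤x-y ≤-refl)

    y-ι-− : ∀ {b} → b ≤ a → ((x - y) ∧ a) ∨ b ≡ (Δr ∧ a) ∨ Δy b ∨ b
    y-ι-− b≤a = ≤-antisym
      (∨-least (∧-mono-≤ x-y≤Δr∨Δy∨b ≤-refl ⟨≤⟩ ∧-distribʳ-∨-≤ ⟨≤⟩ ∨-least x≤x∨y
                 (∧-distribʳ-∨-≤ ⟨≤⟩ ∨-least (x∧y≤x ⟨≤⟩ x≤x∨y ⟨≤⟩ y≤x∨y) (x∧y≤x ⟨≤⟩ y≤x∨y ⟨≤⟩ y≤x∨y)))
               (y≤x∨y ⟨≤⟩ y≤x∨y))
      (∨-least (∧-mono-≤ Δr≤x-y ≤-refl ⟨≤⟩ x≤x∨y)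
               (∨-least (∧-greatest Δy≤x-y (x-y≤x ⟨≤⟩ ∨-least x∧y≤y b≤a) ⟨≤⟩ x≤x∨y) y≤x∨y))

    z-ι-− : (x - y) ∧ c ≡ (Δr ∨ Δy b₂ ∨ Δy b₁ ∨ Δz) ∧ c
    z-ι-− = ≤-antisym (∧-greatest (x∧y≤x ⟨≤⟩ x-y≤Δr∨Δy₂∨Δy₁∨Δz) x∧y≤y)
      (∧-∨-least (∧-mono-≤ Δr≤x-y ≤-refl) (∧-∨-least (∧-mono-≤ Δy≤x-y ≤-refl)
        (∧-∨-least (∧-mono-≤ Δy≤x-y ≤-refl) (∧-mono-≤ Δz≤x-y ≤-refl))))

  ι-isHom : IsHom L L′ ι
  ι-isHom = record
    { pres-𝟎 = Quad-≡ (ι 𝟎) 𝟎′ 𝟎≤x y-bottom y-bottom (x≤𝟎⇒x≡𝟎 x∧y≤x)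
    ; pres-𝟏 = Quad-≡ (ι 𝟏) 𝟏′ (≤-antisym x≤𝟏 x≤x∨y) (y-top b₂≤a) (y-top b₁≤a)
        (≤-antisym x∧y≤y (∧-greatest x≤𝟏 ≤-refl))
    ; pres-∨ = λ x y → Quad-≡ (ι (x ∨ y)) (ι x ∨′ ι y)
        (≤-antisym (∨-least (∨-mono-≤ x≤x∨y x≤x∨y) (y≤x∨y ⟨≤⟩ y≤x∨y))
                   (∨-least (∨-mono-≤ x≤x∨y ≤-refl) (∨-mono-≤ y≤x∨y ≤-refl)))
        (y-∨ b₂) (y-∨ b₁)
        (≤-antisym ∧-distribʳ-∨-≤ (∨-least (∧-mono-≤ x≤x∨y ≤-refl) (∧-mono-≤ y≤x∨y ≤-refl)))
    ; pres-∧ = λ x y → Quad-≡ (ι (x ∧ y)) (ι x ∧′ ι y)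
        (≤-antisym (∧-greatest (∨-mono-≤ x∧y≤x ≤-refl) (∨-mono-≤ x∧y≤y ≤-refl)) ∨-distribʳ-∧-≤)
        (y-∧ b₂) (y-∧ b₁)
        (≤-antisym (∧-greatest (∧-mono-≤ x∧y≤x ≤-refl) (∧-mono-≤ x∧y≤y ≤-refl)) ∧∧-reassoc)
    ; pres-− = λ x y → let open ι-− x y in
        Quad-≡ (ι (x - y)) (ι x -′ ι y) r-ι-− (y-ι-− b₂≤a) (y-ι-− b₁≤a) z-ι-−
    }
    where
      y-bottom : ∀ {b} → (𝟎 ∧ a) ∨ b ≡ b
      y-bottom = ≤-antisym (∨-least (x∧y≤x ⟨≤⟩ 𝟎≤x) ≤-refl) y≤x∨y

      y-top : ∀ {b} → b ≤ a → (𝟏 ∧ a) ∨ b ≡ a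
      y-top b≤a = ≤-antisym (∨-least x∧y≤y b≤a) (∧-greatest x≤𝟏 ≤-refl ⟨≤⟩ x≤x∨y)

      y-∨ : ∀ b {x y} → ((x ∨ y) ∧ a) ∨ b ≡ ((x ∧ a) ∨ b) ∨ ((y ∧ a) ∨ b)
      y-∨ b = ≤-antisym (∨-least (∧-distribʳ-∨-≤ ⟨≤⟩ ∨-mono-≤ x≤x∨y x≤x∨y) (y≤x∨y ⟨≤⟩ x≤x∨y))
        (∨-least (∨-mono-≤ (∧-mono-≤ x≤x∨y ≤-refl) ≤-refl) (∨-mono-≤ (∧-mono-≤ y≤x∨y ≤-refl) ≤-refl))

      ∧∧-reassoc : ∀ {x y t} → (x ∧ t) ∧ (y ∧ t) ≤ (x ∧ y) ∧ t
      ∧∧-reassoc = ∧-greatest (∧-greatest (x∧y≤x ⟨≤⟩ x∧y≤x) (x∧y≤y ⟨≤⟩ x∧y≤x)) (x∧y≤x ⟨≤⟩ x∧y≤y)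

      y-∧ : ∀ b {x y} → ((x ∧ y) ∧ a) ∨ b ≡ ((x ∧ a) ∨ b) ∧ ((y ∧ a) ∨ b)
      y-∧ b = ≤-antisym
        (∧-greatest (∨-mono-≤ (∧-mono-≤ x∧y≤x ≤-refl) ≤-refl) (∨-mono-≤ (∧-mono-≤ x∧y≤y ≤-refl) ≤-refl))
        (∨-distribʳ-∧-≤ ⟨≤⟩ ∨-mono-≤ ∧∧-reassoc ≤-refl)

  ι-reflects-≤ : ∀ {x y} → ι x ≡ ι y → x ≤ y
  ι-reflects-≤ {x} {y} ιx≡ιy =
      x≤y∨z⇒x≤x∧y∨z (x≤x∨y ⟨≤⟩ ≤-reflexive (cong r ιx≡ιy) ⟨≤⟩ ≤-reflexive (∨-comm y a))
      ⟨≤⟩ ∨-least x∧a≤y ≤-refl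
    where
      -- The middle coordinates of ι y meet in (y ∧ a) ∨ c, and the last one identifies x ∧ c with y ∧ c.
      x∧a≤y : x ∧ a ≤ y
      x∧a≤y = ∧-greatest x∧y≤x (∧-greatest x≤x∨y x≤x∨y
                ⟨≤⟩ ≤-reflexive (cong₂ _∧_ (cong y₂ ιx≡ιy) (cong y₁ ιx≡ιy)) ⟨≤⟩ ∨-distribˡ-∧-≤)
        ⟨≤⟩ ∧-distribˡ-∨-≤ ⟨≤⟩ ∨-least (x∧y≤y ⟨≤⟩ x∧y≤x) (≤-reflexive (cong z ιx≡ιy) ⟨≤⟩ x∧y≤x)

  ι-embedding : Embedding L L′
  ι-embedding = record
    { map = ι
    ; isHom = ι-isHom
    ; inj = λ ιx≡ιy → ≤-antisym (ι-reflects-≤ ιx≡ιy) (ι-reflects-≤ (sym ιx≡ιy))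
    }

  a₁ : Quad
  a₁ = quad a a b₁ c ≤-refl b₂≤a ≤-refl ≤-refl b₁≤a ≤-refl x∧y≤y
    (x∧y≤x ⟨≤⟩ x≤y⇒x-y≤𝟎 ≤-refl ⟨≤⟩ 𝟎≤x) x∧y≤y x∧y≤y x∧y≤y

  a₂ : Quad
  a₂ = quad a b₂ a c ≤-refl ≤-refl b₂≤a b₁≤a ≤-refl ≤-refl
    (x∧y≤x ⟨≤⟩ x≤y⇒x-y≤𝟎 ≤-refl ⟨≤⟩ 𝟎≤x) x∧y≤y x∧y≤y x∧y≤y x∧y≤y

  ιb₁≤a₁ : ι b₁ ≤′ a₁
  ιb₁≤a₁ = ≤′-intro {ι b₁} {a₁} (∨-least b₁≤a ≤-refl) (∨-least x∧y≤y b₂≤a) (∨-least x∧y≤x ≤-refl) x∧y≤y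

  ιb₂≤a₂ : ι b₂ ≤′ a₂
  ιb₂≤a₂ = ≤′-intro {ι b₂} {a₂} (∨-least b₂≤a ≤-refl) (∨-least x∧y≤x ≤-refl) (∨-least x∧y≤y b₁≤a) x∧y≤y

  a₁∧a₂≡ιc : a₁ ∧′ a₂ ≡ ι c
  a₁∧a₂≡ιc = Quad-≡ (a₁ ∧′ a₂) (ι c)
    (≤-antisym (x∧y≤x ⟨≤⟩ y≤x∨y) (∨-least (c≤a ⟨≤⟩ ∧-greatest ≤-refl ≤-refl) (∧-greatest ≤-refl ≤-refl)))
    (≤-antisym (x∧y≤y ⟨≤⟩ y≤x∨y) (∨-least (x∧y≤x ⟨≤⟩ x∧y≤y ⟨≤⟩ ∧-greatest b₂≤a ≤-refl) (∧-greatest b₂≤a ≤-refl)))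
    (≤-antisym (x∧y≤x ⟨≤⟩ y≤x∨y) (∨-least (x∧y≤x ⟨≤⟩ x∧y≤x ⟨≤⟩ ∧-greatest ≤-refl b₁≤a) (∧-greatest ≤-refl b₁≤a)))
    refl

  module _ (a-[b₁∨b₂]≡a : a - (b₁ ∨ b₂) ≡ a) where
    a≤a-b : ∀ {b} → b ≤ b₁ ∨ b₂ → a ≤ a - b
    a≤a-b b≤b₁∨b₂ = ≤-reflexive (sym a-[b₁∨b₂]≡a) ⟨≤⟩ −-antimonoʳ-≤ b≤b₁∨b₂

    a≤[a∧a∨b]-b : ∀ {b} → b ≤ b₁ ∨ b₂ → a ≤ ((a ∧ a) ∨ b) - b
    a≤[a∧a∨b]-b b≤b₁∨b₂ = a≤a-b b≤b₁∨b₂ ⟨≤⟩ −-monoˡ-≤ (∧-greatest ≤-refl ≤-refl ⟨≤⟩ x≤x∨y)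

    r-ιa-a : ((a ∨ a) - a) ∨ a ≡ a
    r-ιa-a = ≤-antisym (∨-least (x≤y⇒x-y≤𝟎 (∨-least ≤-refl ≤-refl) ⟨≤⟩ 𝟎≤x) ≤-refl) y≤x∨y

    [a∧a∨b]-a≤𝟎 : ∀ {b} → b ≤ a → ((a ∧ a) ∨ b) - a ≤ 𝟎
    [a∧a∨b]-a≤𝟎 b≤a = x≤y⇒x-y≤𝟎 (∨-least x∧y≤x b≤a)

    [a∨a]-a≤𝟎 : (a ∨ a) - a ≤ 𝟎
    [a∨a]-a≤𝟎 = x≤y⇒x-y≤𝟎 (∨-least ≤-refl ≤-refl)

    ιa-a₂≡a₁ : ι a -′ a₂ ≡ a₁
    ιa-a₂≡a₁ = Quad-≡ (ι a -′ a₂) a₁ r-ιa-a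
      (≤-antisym (∨-least x∧y≤y (∨-least (x-y≤x ⟨≤⟩ ∨-least x∧y≤x b₂≤a) b₂≤a))
                 (a≤[a∧a∨b]-b y≤x∨y ⟨≤⟩ x≤x∨y ⟨≤⟩ y≤x∨y))
      (≤-antisym (∨-least (x∧y≤x ⟨≤⟩ [a∨a]-a≤𝟎 ⟨≤⟩ 𝟎≤x) (∨-least ([a∧a∨b]-a≤𝟎 b₁≤a ⟨≤⟩ 𝟎≤x) ≤-refl))
                 (y≤x∨y ⟨≤⟩ y≤x∨y))
      (≤-antisym x∧y≤y (∧-greatest (c≤a ⟨≤⟩ a≤[a∧a∨b]-b y≤x∨y ⟨≤⟩ x≤x∨y ⟨≤⟩ y≤x∨y) ≤-refl))

    ιa-a₁≡a₂ : ι a -′ a₁ ≡ a₂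
    ιa-a₁≡a₂ = Quad-≡ (ι a -′ a₁) a₂ r-ιa-a
      (≤-antisym (∨-least (x∧y≤x ⟨≤⟩ [a∨a]-a≤𝟎 ⟨≤⟩ 𝟎≤x) (∨-least ([a∧a∨b]-a≤𝟎 b₂≤a ⟨≤⟩ 𝟎≤x) ≤-refl))
                 (y≤x∨y ⟨≤⟩ y≤x∨y))
      (≤-antisym (∨-least x∧y≤y (∨-least (x-y≤x ⟨≤⟩ ∨-least x∧y≤x b₁≤a) b₁≤a))
                 (a≤[a∧a∨b]-b x≤x∨y ⟨≤⟩ x≤x∨y ⟨≤⟩ y≤x∨y))
      (≤-antisym x∧y≤y (∧-greatest (c≤a ⟨≤⟩ a≤[a∧a∨b]-b x≤x∨y ⟨≤⟩ x≤x∨y ⟨≤⟩ y≤x∨y ⟨≤⟩ y≤x∨y) ≤-refl))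

    a≢𝟎⇒a₁≢𝟎′×a₂≢𝟎′ : a ≢ 𝟎 → (a₁ ≢ 𝟎′) × (a₂ ≢ 𝟎′)
    a≢𝟎⇒a₁≢𝟎′×a₂≢𝟎′ a≢𝟎 =
        (λ a₁≡𝟎′ → a≢𝟎 (x≤𝟎⇒x≡𝟎 (a≤a-b y≤x∨y ⟨≤⟩ x≤y⇒x-y≤𝟎 (≤-reflexive (cong y₁ a₁≡𝟎′)))))
      , (λ a₂≡𝟎′ → a≢𝟎 (x≤𝟎⇒x≡𝟎 (a≤a-b x≤x∨y ⟨≤⟩ x≤y⇒x-y≤𝟎 (≤-reflexive (cong y₂ a₂≡𝟎′)))))

lemma5p3 : (L : CoHeyting) → Finite L → InV₂ L → CoHeyting.JoinIrreducible L (CoHeyting.𝟏 L) →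
    (a b₁ b₂ : CoHeyting.Carrier L) →
    CoHeyting._≪_ L (CoHeyting._∨_ L b₁ b₂) a →
    CoHeyting._∧_ L (CoHeyting._∧_ L b₁ b₂) (CoHeyting._-_ L (CoHeyting.𝟏 L) (CoHeyting._-_ L (CoHeyting.𝟏 L) a)) ≡ CoHeyting.𝟎 L →
    Σ CoHeyting λ L' → InV₂ L' × Σ (Embedding L L') λ e →
      Σ (CoHeyting.Carrier L') λ a₁ → Σ (CoHeyting.Carrier L') λ a₂ →
        let h = Embedding.map e in
        (CoHeyting._-_ L' (h a) a₂ ≡ a₁) × CoHeyting._≤_ L' (h b₁) a₁ ×
        (CoHeyting._-_ L' (h a) a₁ ≡ a₂) × CoHeyting._≤_ L' (h b₂) a₂ ×
        (CoHeyting._∧_ L' a₁ a₂ ≡ h (CoHeyting._∧_ L b₁ b₂)) ×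
        (a ≢ CoHeyting.𝟎 L → (a₁ ≢ CoHeyting.𝟎 L') × (a₂ ≢ CoHeyting.𝟎 L'))
lemma5p3 L _ v₂ _ a b₁ b₂ (a-[b₁∨b₂]≡a , b₁∨b₂≤a) c∧∼∼a≡𝟎 =
    L′ , L′-InV₂ v₂ c≤∼a , ι-embedding , a₁ , a₂
  , ιa-a₂≡a₁ a-[b₁∨b₂]≡a , ιb₁≤a₁ , ιa-a₁≡a₂ a-[b₁∨b₂]≡a , ιb₂≤a₂ , a₁∧a₂≡ιc
  , a≢𝟎⇒a₁≢𝟎′×a₂≢𝟎′ a-[b₁∨b₂]≡a
  where
    open CoHeytingProperties L
    open Extension L (x≤x∨y ⟨≤⟩ b₁∨b₂≤a) (y≤x∨y ⟨≤⟩ b₁∨b₂≤a)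

    c≤∼a : c ≤ ∼ a
    c≤∼a = x∧∼y≤𝟎⇒x≤y (≤-reflexive c∧∼∼a≡𝟎)
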